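{- For all integers $n>1$, $a\ge2$ and $p\ge2$, $$\sum_{k\mid n}\mu(n/k)a^{pk}>p\sum_{k\mid n}\mu(n/k)a^k,$$ where $\mu$ is the Möbius function. -}

module Defs where

open import Data.Nat using (ℕ; zero; suc; _*_; _≤_; _<_; _/_; _%_; _≡ᵇ_)
open import Data.Nat.Divisibility using (_∣?_)
open import Data.Integer as ℤ using (ℤ; +_)
open import Data.List using (List; upTo; map; filter; foldr)
open import Data.Bool using (Bool; true; false; if_then_else_)

-- This is the standard μ : μ(n) = 0 if n has a squared prime factor,
-- else (-1)^(number of distinct prime factors). μ(0) := 0 (never used).
-- μ-aux fuel m d : Möbius of m, knowing m has no prime factor < d (d ≥ 2).
μ-aux : ℕ → ℕ → ℕ → ℤ
μ-aux zero       m d = + 1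
μ-aux (suc fuel) zero d = + 0
μ-aux (suc fuel) (suc zero) d = + 1
μ-aux (suc fuel) m@(suc (suc _)) d@(suc (suc _)) with m % d ≡ᵇ 0
... | false = μ-aux fuel m (suc d)
... | true with (m / d) % d ≡ᵇ 0
...   | true  = + 0
...   | false = ℤ.- μ-aux fuel (m / d) d
μ-aux (suc fuel) m@(suc (suc _)) d = μ-aux fuel m (suc (suc zero))

μ : ℕ → ℤ
μ n = μ-aux (suc (n * n)) n 2

-- Σ_{k ∣ n} f k (n / k)   : the summand also receives the complementary
-- divisor n / k (computed here, where k = suc j is visibly nonzero).
sumDivisors : ℕ → (ℕ → ℕ → ℤ) → ℤ
sumDivisors n f = foldr ℤ._+_ (+ 0) (map (λ j → f (suc j) (n / suc j)) (filter (λ j → suc j ∣? n) (upTo n)))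

-- Write Σ_{k ∣ n} μ(n/k) xᵏ = xⁿ + R, where R is the sum over the proper divisors k, all ≤ n/2.
-- As |μ| ≤ 1, |R| ≤ x + x² + ⋯ + x^⌊n/2⌋ ≤ 2x^⌊n/2⌋ − 2, and therefore 2|R| ≤ xⁿ.
-- With N = aⁿ the left-hand side is thus at most 3pN/2 and the right-hand side at least Nᵖ/2,
-- so the inequality holds once 3pN < Nᵖ; since N ≥ 4 this fails only for n = a = p = 2,
-- which is checked directly.
module Submission where

open import Defs
open import Data.Nat using (ℕ; _^_)
open import Data.Integer using (ℤ; +_; _*_; _<_)
open import Data.Nat.Base using (_≤_)

open import Data.Nat.Base as ℕ using (zero; suc; _/_; _%_; _≡ᵇ_; z≤n; s≤s)
import Data.Nat.Properties as ℕ
open import Data.Nat.DivMod using (n/n≡1)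
open import Data.Nat.Divisibility using (_∣_; _∣?_; divides; ∣-refl)
import Data.Integer.Base as ℤ
import Data.Integer.Properties as ℤ
open import Data.List.Base using (List; []; _∷_; _++_; [_]; map; filter; foldr; upTo)
open import Data.List.Properties using (upTo-∷ʳ; filter-++; filter-accept; filter-reject; map-++; map-cong)
open import Data.Product.Base using (∃-syntax; _×_; _,_)
open import Data.Sum.Base using (_⊎_; inj₁; inj₂)
open import Data.Bool.Base using (true; false)
open import Relation.Nullary using (¬_; yes; no)
open import Relation.Nullary.Decidable using (from-yes)
open import Data.Empty using (⊥-elim)
open import Relation.Binary.PropositionalEquality using (_≡_; refl; sym; trans; cong; subst; module ≡-Reasoning)
open import Function.Base using (_∘_)
open import Data.Nat.Tactic.RingSolver using (solve-∀)

∣μ-aux∣≤1 : ∀ fuel m d → ℤ.∣ μ-aux fuel m d ∣ ℕ.≤ 1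
∣μ-aux∣≤1 zero m d = s≤s z≤n
∣μ-aux∣≤1 (suc fuel) zero d = z≤n
∣μ-aux∣≤1 (suc fuel) (suc zero) d = ℕ.≤-refl
∣μ-aux∣≤1 (suc fuel) (suc (suc m)) zero = ∣μ-aux∣≤1 fuel _ _
∣μ-aux∣≤1 (suc fuel) (suc (suc m)) (suc zero) = ∣μ-aux∣≤1 fuel _ _
∣μ-aux∣≤1 (suc fuel) (suc (suc m)) (suc (suc d)) with suc (suc m) % suc (suc d) ≡ᵇ 0
... | false = ∣μ-aux∣≤1 fuel _ _
... | true with (suc (suc m) / suc (suc d)) % suc (suc d) ≡ᵇ 0
...   | true = z≤n
...   | false = subst (ℕ._≤ 1) (sym (ℤ.∣-i∣≡∣i∣ (μ-aux fuel _ _))) (∣μ-aux∣≤1 fuel _ _)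

∣μ∣≤1 : ∀ m → ℤ.∣ μ m ∣ ℕ.≤ 1
∣μ∣≤1 m = ∣μ-aux∣≤1 (suc (m ℕ.* m)) m 2

∣μ*n∣≤n : ∀ m n → ℤ.∣ μ m * + n ∣ ℕ.≤ n
∣μ*n∣≤n m n = begin
  ℤ.∣ μ m * + n ∣      ≡⟨ ℤ.∣i*j∣≡∣i∣*∣j∣ (μ m) (+ n) ⟩
  ℤ.∣ μ m ∣ ℕ.* n      ≤⟨ ℕ.*-monoˡ-≤ n (∣μ∣≤1 m) ⟩
  1 ℕ.* n              ≡⟨ ℕ.*-identityˡ n ⟩
  n                    ∎
  where open ℕ.≤-Reasoning

sumℤ : List ℤ → ℤ
sumℤ = foldr ℤ._+_ (+ 0)

sumℤ-++ : ∀ xs ys → sumℤ (xs ++ ys) ≡ sumℤ xs ℤ.+ sumℤ ys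
sumℤ-++ []       ys = sym (ℤ.+-identityˡ (sumℤ ys))
sumℤ-++ (x ∷ xs) ys = trans (cong (λ s → x ℤ.+ s) (sumℤ-++ xs ys)) (sym (ℤ.+-assoc x (sumℤ xs) (sumℤ ys)))

module _ (n : ℕ) (f : ℕ → ℕ → ℤ) where

  divisorTerm : ℕ → ℤ
  divisorTerm j = f (suc j) (n / suc j)

  partialDivisorSum : ℕ → ℤ
  partialDivisorSum c = sumℤ (map divisorTerm (filter (λ j → suc j ∣? n) (upTo c)))

  partialDivisorSum-suc : ∀ c →
    partialDivisorSum (suc c) ≡ partialDivisorSum c ℤ.+ sumℤ (map divisorTerm (filter (λ j → suc j ∣? n) [ c ]))
  partialDivisorSum-suc c = begin
    partialDivisorSum (suc c)                                       ≡⟨ cong (λ xs → sumℤ (map divisorTerm (filter P? xs))) (sym (upTo-∷ʳ c)) ⟩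
    sumℤ (map divisorTerm (filter P? (upTo c ++ [ c ])))            ≡⟨ cong (sumℤ ∘ map divisorTerm) (filter-++ P? (upTo c) [ c ]) ⟩
    sumℤ (map divisorTerm (filter P? (upTo c) ++ filter P? [ c ]))  ≡⟨ cong sumℤ (map-++ divisorTerm (filter P? (upTo c)) _) ⟩
    sumℤ (map divisorTerm (filter P? (upTo c)) ++ _)                ≡⟨ sumℤ-++ (map divisorTerm (filter P? (upTo c))) _ ⟩
    partialDivisorSum c ℤ.+ _                                       ∎
    where
    open ≡-Reasoning
    P? = λ j → suc j ∣? n

  partialDivisorSum-divisor : ∀ {c} → suc c ∣ n → partialDivisorSum (suc c) ≡ partialDivisorSum c ℤ.+ divisorTerm c
  partialDivisorSum-divisor {c} c+1∣n = begin
    partialDivisorSum (suc c)                          ≡⟨ partialDivisorSum-suc c ⟩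
    partialDivisorSum c ℤ.+ _                          ≡⟨ cong (λ l → partialDivisorSum c ℤ.+ sumℤ (map divisorTerm l))
                                                               (filter-accept (λ j → suc j ∣? n) c+1∣n) ⟩
    partialDivisorSum c ℤ.+ (divisorTerm c ℤ.+ + 0)    ≡⟨ cong (λ s → partialDivisorSum c ℤ.+ s) (ℤ.+-identityʳ (divisorTerm c)) ⟩
    partialDivisorSum c ℤ.+ divisorTerm c              ∎
    where open ≡-Reasoning

  partialDivisorSum-nondivisor : ∀ {c} → ¬ suc c ∣ n → partialDivisorSum (suc c) ≡ partialDivisorSum c
  partialDivisorSum-nondivisor {c} c+1∤n = begin
    partialDivisorSum (suc c)            ≡⟨ partialDivisorSum-suc c ⟩
    partialDivisorSum c ℤ.+ _            ≡⟨ cong (λ l → partialDivisorSum c ℤ.+ sumℤ (map divisorTerm l))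
                                                 (filter-reject (λ j → suc j ∣? n) c+1∤n) ⟩
    partialDivisorSum c ℤ.+ + 0          ≡⟨ ℤ.+-identityʳ (partialDivisorSum c) ⟩
    partialDivisorSum c                  ∎
    where open ≡-Reasoning

sumDivisors-split : ∀ m f → sumDivisors (suc m) f ≡ partialDivisorSum (suc m) f m ℤ.+ f (suc m) 1
sumDivisors-split m f = trans (partialDivisorSum-divisor (suc m) f ∣-refl)
                              (cong (λ l → partialDivisorSum (suc m) f m ℤ.+ f (suc m) l) (n/n≡1 (suc m)))

sumDivisors-cong : ∀ n {f g : ℕ → ℕ → ℤ} → (∀ k l → f k l ≡ g k l) → sumDivisors n f ≡ sumDivisors n g
sumDivisors-cong n f≡g = cong sumℤ (map-cong (λ j → f≡g (suc j) (n / suc j)) (filter (λ j → suc j ∣? n) (upTo n)))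

∣∧<⇒2*≤ : ∀ {d n} → d ∣ n → d ℕ.< n → 2 ℕ.* d ℕ.≤ n
∣∧<⇒2*≤ (divides 0 refl) ()
∣∧<⇒2*≤ {d} (divides 1 refl) d<d+0 = ⊥-elim (ℕ.<-irrefl (sym (ℕ.+-identityʳ d)) d<d+0)
∣∧<⇒2*≤ {d} (divides (suc (suc q)) refl) _ = ℕ.*-monoˡ-≤ d (s≤s (s≤s (z≤n {q})))

2*x^e≤x^[1+c] : ∀ {x e c} → 2 ℕ.≤ x → e ℕ.≤ c → 2 ℕ.* x ^ e ℕ.≤ x ^ suc c
2*x^e≤x^[1+c] {x@(suc _)} {e} 2≤x e≤c = ℕ.≤-trans (ℕ.*-monoˡ-≤ (x ^ e) 2≤x) (ℕ.^-monoʳ-≤ x (s≤s e≤c))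

-- Scanning the divisors in increasing order: if e is the largest proper divisor of n seen so far,
-- the partial sum is dominated by x + x² + ⋯ + xᵉ ≤ 2xᵉ − 2, and e ≤ n/2.
module _ {n x : ℕ} (f : ℕ → ℕ → ℤ) (2≤x : 2 ℕ.≤ x) (∣f∣≤x^ : ∀ k l → ℤ.∣ f k l ∣ ℕ.≤ x ^ k) where

  partialDivisorSum-bound : ∀ c → c ℕ.< n →
    ∃[ e ] 2 ℕ.* e ℕ.≤ n × e ℕ.≤ c × ℤ.∣ partialDivisorSum n f c ∣ ℕ.+ 2 ℕ.≤ 2 ℕ.* x ^ e
  partialDivisorSum-bound zero _ = 0 , z≤n , z≤n , ℕ.≤-refl
  partialDivisorSum-bound (suc c) c+1<n
    with suc c ∣? n | partialDivisorSum-bound c (ℕ.<-trans (ℕ.n<1+n c) c+1<n)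
  ... | no c+1∤n | e , 2e≤n , e≤c , bound =
    e , 2e≤n , ℕ.m≤n⇒m≤1+n e≤c ,
    subst (λ s → ℤ.∣ s ∣ ℕ.+ 2 ℕ.≤ 2 ℕ.* x ^ e) (sym (partialDivisorSum-nondivisor n f c+1∤n)) bound
  ... | yes c+1∣n | e , _ , e≤c , bound = suc c , ∣∧<⇒2*≤ c+1∣n c+1<n , ℕ.≤-refl , (begin
    ℤ.∣ partialDivisorSum n f (suc c) ∣ ℕ.+ 2  ≡⟨ cong (λ s → ℤ.∣ s ∣ ℕ.+ 2) (partialDivisorSum-divisor n f c+1∣n) ⟩
    ℤ.∣ G ℤ.+ t ∣ ℕ.+ 2                        ≤⟨ ℕ.+-monoˡ-≤ 2 (ℤ.∣i+j∣≤∣i∣+∣j∣ G t) ⟩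
    (ℤ.∣ G ∣ ℕ.+ ℤ.∣ t ∣) ℕ.+ 2                ≡⟨ +-swap₂ ℤ.∣ G ∣ ℤ.∣ t ∣ ⟩
    (ℤ.∣ G ∣ ℕ.+ 2) ℕ.+ ℤ.∣ t ∣                ≤⟨ ℕ.+-mono-≤ bound (∣f∣≤x^ (suc c) (n / suc c)) ⟩
    2 ℕ.* x ^ e ℕ.+ x ^ suc c                  ≤⟨ ℕ.+-monoˡ-≤ (x ^ suc c) (2*x^e≤x^[1+c] 2≤x e≤c) ⟩
    x ^ suc c ℕ.+ x ^ suc c                    ≡⟨ cong (x ^ suc c ℕ.+_) (sym (ℕ.+-identityʳ (x ^ suc c))) ⟩
    2 ℕ.* x ^ suc c                            ∎)
    where
    open ℕ.≤-Reasoning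
    G = partialDivisorSum n f c
    t = divisorTerm n f c
    +-swap₂ : ∀ a b → (a ℕ.+ b) ℕ.+ 2 ≡ (a ℕ.+ 2) ℕ.+ b
    +-swap₂ = solve-∀

4*z≤z*z+4 : ∀ z → 4 ℕ.* z ℕ.≤ z ℕ.* z ℕ.+ 4
4*z≤z*z+4 0 = z≤n
4*z≤z*z+4 1 = s≤s (s≤s (s≤s (s≤s z≤n)))
4*z≤z*z+4 2 = ℕ.≤-refl
4*z≤z*z+4 3 = ℕ.n≤1+n 12
4*z≤z*z+4 z@(suc (suc (suc (suc w)))) =
  ℕ.≤-trans (ℕ.*-monoˡ-≤ z (s≤s (s≤s (s≤s (s≤s (z≤n {w})))))) (ℕ.m≤m+n (z ℕ.* z) 4)

α+2≤2z∧z*z≤N⇒2α≤N : ∀ {α z N} → α ℕ.+ 2 ℕ.≤ 2 ℕ.* z → z ℕ.* z ℕ.≤ N → 2 ℕ.* α ℕ.≤ N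
α+2≤2z∧z*z≤N⇒2α≤N {α} {z} {N} α+2≤2z z*z≤N = ℕ.+-cancelʳ-≤ 4 (2 ℕ.* α) N (begin
  2 ℕ.* α ℕ.+ 4      ≡⟨ double-+2 α ⟩
  2 ℕ.* (α ℕ.+ 2)    ≤⟨ ℕ.*-monoʳ-≤ 2 α+2≤2z ⟩
  2 ℕ.* (2 ℕ.* z)    ≡⟨ ℕ.*-assoc 2 2 z ⟨
  4 ℕ.* z            ≤⟨ 4*z≤z*z+4 z ⟩
  z ℕ.* z ℕ.+ 4      ≤⟨ ℕ.+-monoˡ-≤ 4 z*z≤N ⟩
  N ℕ.+ 4            ∎)
  where
  open ℕ.≤-Reasoning
  double-+2 : ∀ a → 2 ℕ.* a ℕ.+ 4 ≡ 2 ℕ.* (a ℕ.+ 2)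
  double-+2 = solve-∀

2e≤n⇒x^e*x^e≤x^n : ∀ {x e n} → 1 ℕ.≤ x → 2 ℕ.* e ℕ.≤ n → x ^ e ℕ.* x ^ e ℕ.≤ x ^ n
2e≤n⇒x^e*x^e≤x^n {x@(suc _)} {e} {n} _ 2e≤n = begin
  x ^ e ℕ.* x ^ e      ≡⟨ ℕ.^-distribˡ-+-* x e e ⟨
  x ^ (e ℕ.+ e)        ≡⟨ cong (λ k → x ^ (e ℕ.+ k)) (ℕ.+-identityʳ e) ⟨
  x ^ (2 ℕ.* e)        ≤⟨ ℕ.^-monoʳ-≤ x 2e≤n ⟩
  x ^ n                ∎
  where open ℕ.≤-Reasoning

properDivisorSum-bound : ∀ {m x} f → 2 ℕ.≤ x → (∀ k l → ℤ.∣ f k l ∣ ℕ.≤ x ^ k) →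
  2 ℕ.* ℤ.∣ partialDivisorSum (suc m) f m ∣ ℕ.≤ x ^ suc m
properDivisorSum-bound {m} {x} f 2≤x ∣f∣≤x^ with partialDivisorSum-bound f 2≤x ∣f∣≤x^ m (ℕ.n<1+n m)
... | e , 2e≤n , _ , bound =
  α+2≤2z∧z*z≤N⇒2α≤N {z = x ^ e} bound (2e≤n⇒x^e*x^e≤x^n {e = e} (ℕ.≤-trans (s≤s z≤n) 2≤x) 2e≤n)

p*[α+N]+β<M : ∀ p {α β N M} → 2 ℕ.* α ℕ.≤ N → 2 ℕ.* β ℕ.≤ M → 3 ℕ.* p ℕ.* N ℕ.< M →
  p ℕ.* (α ℕ.+ N) ℕ.+ β ℕ.< M
p*[α+N]+β<M p {α} {β} {N} {M} 2α≤N 2β≤M 3pN<M = ℕ.*-cancelˡ-< 2 _ _ (begin-strict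
  2 ℕ.* (p ℕ.* (α ℕ.+ N) ℕ.+ β)                    ≡⟨ expand p α β N ⟩
  p ℕ.* (2 ℕ.* α) ℕ.+ 2 ℕ.* p ℕ.* N ℕ.+ 2 ℕ.* β    ≤⟨ ℕ.+-mono-≤ (ℕ.+-monoˡ-≤ (2 ℕ.* p ℕ.* N) (ℕ.*-monoʳ-≤ p 2α≤N)) 2β≤M ⟩
  p ℕ.* N ℕ.+ 2 ℕ.* p ℕ.* N ℕ.+ M                  ≡⟨ collect p N M ⟩
  3 ℕ.* p ℕ.* N ℕ.+ M                              <⟨ ℕ.+-monoˡ-< M 3pN<M ⟩
  M ℕ.+ M                                          ≡⟨ cong (M ℕ.+_) (ℕ.+-identityʳ M) ⟨
  2 ℕ.* M                                          ∎)
  where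
  open ℕ.≤-Reasoning
  expand : ∀ p α β N → 2 ℕ.* (p ℕ.* (α ℕ.+ N) ℕ.+ β) ≡ p ℕ.* (2 ℕ.* α) ℕ.+ 2 ℕ.* p ℕ.* N ℕ.+ 2 ℕ.* β
  expand = solve-∀
  collect : ∀ p N M → p ℕ.* N ℕ.+ 2 ℕ.* p ℕ.* N ℕ.+ M ≡ 3 ℕ.* p ℕ.* N ℕ.+ M
  collect = solve-∀

i≤+∣i∣ : ∀ i → i ℤ.≤ + ℤ.∣ i ∣
i≤+∣i∣ (+ n)      = ℤ.≤-refl
i≤+∣i∣ ℤ.-[1+ n ] = ℤ.-≤+

0≤+∣i∣+i : ∀ i → + 0 ℤ.≤ + ℤ.∣ i ∣ ℤ.+ i
0≤+∣i∣+i (+ n)      = ℤ.+≤+ z≤n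
0≤+∣i∣+i ℤ.-[1+ n ] = ℤ.≤-reflexive (sym (ℤ.n⊖n≡0 (suc n)))

+p*[A+N]<B+M : ∀ p A B {N M} → 2 ℕ.* ℤ.∣ A ∣ ℕ.≤ N → 2 ℕ.* ℤ.∣ B ∣ ℕ.≤ M → 3 ℕ.* p ℕ.* N ℕ.< M →
  + p * (A ℤ.+ + N) < B ℤ.+ + M
+p*[A+N]<B+M p A B {N} {M} 2∣A∣≤N 2∣B∣≤M 3pN<M = begin-strict
  + p * (A ℤ.+ + N)                   ≤⟨ ℤ.*-monoˡ-≤-nonNeg (+ p) (ℤ.+-monoˡ-≤ (+ N) (i≤+∣i∣ A)) ⟩
  + p * (+ ℤ.∣ A ∣ ℤ.+ + N)           ≡⟨ cong (+ p *_) (ℤ.pos-+ ℤ.∣ A ∣ N) ⟨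
  + p * + (ℤ.∣ A ∣ ℕ.+ N)             ≡⟨ ℤ.pos-* p (ℤ.∣ A ∣ ℕ.+ N) ⟨
  + X                                 ≡⟨ ℤ.+-identityʳ (+ X) ⟨
  + X ℤ.+ + 0                         ≤⟨ ℤ.+-monoʳ-≤ (+ X) (0≤+∣i∣+i B) ⟩
  + X ℤ.+ (+ ℤ.∣ B ∣ ℤ.+ B)           ≡⟨ ℤ.+-assoc (+ X) (+ ℤ.∣ B ∣) B ⟨
  (+ X ℤ.+ + ℤ.∣ B ∣) ℤ.+ B           ≡⟨ cong (ℤ._+ B) (ℤ.pos-+ X ℤ.∣ B ∣) ⟨
  + (X ℕ.+ ℤ.∣ B ∣) ℤ.+ B             <⟨ ℤ.+-monoˡ-< B (ℤ.+<+ (p*[α+N]+β<M p 2∣A∣≤N 2∣B∣≤M 3pN<M)) ⟩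
  + M ℤ.+ B                           ≡⟨ ℤ.+-comm (+ M) B ⟩
  B ℤ.+ + M                           ∎
  where
  open ℤ.≤-Reasoning
  X = p ℕ.* (ℤ.∣ A ∣ ℕ.+ N)

^-swap : ∀ x m n → (x ^ m) ^ n ≡ (x ^ n) ^ m
^-swap x m n = begin
  (x ^ m) ^ n      ≡⟨ ℕ.^-*-assoc x m n ⟩
  x ^ (m ℕ.* n)    ≡⟨ cong (x ^_) (ℕ.*-comm m n) ⟩
  x ^ (n ℕ.* m)    ≡⟨ ℕ.^-*-assoc x n m ⟨
  (x ^ n) ^ m      ∎
  where open ≡-Reasoning

m≤m^n : ∀ m .{{_ : ℕ.NonZero m}} {n} → 1 ℕ.≤ n → m ℕ.≤ m ^ n
m≤m^n m {n} 1≤n = subst (ℕ._≤ m ^ n) (ℕ.^-identityʳ m) (ℕ.^-monoʳ-≤ m 1≤n)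

-- Σ_{k ∣ n} μ(n/k) xᵏ counts the primitive words of length n over an x-letter alphabet.
primitiveWordCount : ℕ → ℕ → ℤ
primitiveWordCount n x = sumDivisors n (λ k n/k → μ n/k * + (x ^ k))

primitiveWordCount-^ : ∀ n a p →
  primitiveWordCount n (a ^ p) ≡ sumDivisors n (λ k n/k → μ n/k * + (a ^ (p ℕ.* k)))
primitiveWordCount-^ n a p = sumDivisors-cong n (λ k n/k → cong (λ m → μ n/k * + m) (ℕ.^-*-assoc a p k))

primitiveWordCount-leading : ∀ m {x} → 2 ℕ.≤ x →
  ∃[ A ] primitiveWordCount (suc m) x ≡ A ℤ.+ + (x ^ suc m) × 2 ℕ.* ℤ.∣ A ∣ ℕ.≤ x ^ suc m
primitiveWordCount-leading m {x} 2≤x =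
  partialDivisorSum (suc m) f m ,
  trans (sumDivisors-split m f) (cong (ℤ._+_ (partialDivisorSum (suc m) f m)) (ℤ.*-identityˡ (+ (x ^ suc m)))) ,
  properDivisorSum-bound {m} f 2≤x (λ k n/k → ∣μ*n∣≤n n/k (x ^ k))
  where
  f : ℕ → ℕ → ℤ
  f k n/k = μ n/k * + (x ^ k)

primitiveWordCount-gap : ∀ m {x p} → 2 ℕ.≤ x → 1 ℕ.≤ p → 3 ℕ.* p ℕ.* x ^ suc m ℕ.< (x ^ suc m) ^ p →
  + p * primitiveWordCount (suc m) x < primitiveWordCount (suc m) (x ^ p)
primitiveWordCount-gap m {x@(suc _)} {p} 2≤x 1≤p 3pN<Nᵖ
  with primitiveWordCount-leading m 2≤x | primitiveWordCount-leading m (ℕ.≤-trans 2≤x (m≤m^n x 1≤p))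
... | A , W≡A+N , 2∣A∣≤N | B , W≡B+M , 2∣B∣≤M rewrite W≡A+N | W≡B+M =
  +p*[A+N]<B+M p A B 2∣A∣≤N 2∣B∣≤M (subst (3 ℕ.* p ℕ.* x ^ suc m ℕ.<_) (^-swap x (suc m) p) 3pN<Nᵖ)

3m<X⇒3[1+m]<4X : ∀ {m X} → 3 ℕ.* m ℕ.< X → 3 ℕ.* suc m ℕ.< 4 ℕ.* X
3m<X⇒3[1+m]<4X {m} {X} 3m<X = begin
  suc (3 ℕ.* suc m)          ≡⟨ cong suc (ℕ.*-suc 3 m) ⟩
  suc (3 ℕ.+ 3 ℕ.* m)        ≡⟨ ℕ.+-comm 3 (suc (3 ℕ.* m)) ⟩
  suc (3 ℕ.* m) ℕ.+ 3        ≤⟨ ℕ.+-mono-≤ 3m<X (ℕ.*-monoʳ-≤ 3 (ℕ.≤-trans (s≤s z≤n) 3m<X)) ⟩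
  4 ℕ.* X                    ∎
  where
  open ℕ.≤-Reasoning

3*[3+q]<4^[2+q] : ∀ q → 3 ℕ.* (3 ℕ.+ q) ℕ.< 4 ^ (2 ℕ.+ q)
3*[3+q]<4^[2+q] zero    = ℕ.+-monoʳ-≤ 10 z≤n
3*[3+q]<4^[2+q] (suc q) = 3m<X⇒3[1+m]<4X {3 ℕ.+ q} (3*[3+q]<4^[2+q] q)

3pN<Nᵖ : ∀ {N q} .{{_ : ℕ.NonZero N}} → 3 ℕ.* suc q ℕ.< N ^ q → 3 ℕ.* suc q ℕ.* N ℕ.< N ^ suc q
3pN<Nᵖ {N} {q} 3p<Nᵖ⁻¹ = begin-strict
  3 ℕ.* suc q ℕ.* N    <⟨ ℕ.*-monoˡ-< N 3p<Nᵖ⁻¹ ⟩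
  N ^ q ℕ.* N          ≡⟨ ℕ.*-comm (N ^ q) N ⟩
  N ^ suc q            ∎
  where open ℕ.≤-Reasoning

2≤a⇒a≢0 : ∀ {a} → 2 ℕ.≤ a → ℕ.NonZero a
2≤a⇒a≢0 2≤a = ℕ.>-nonZero (ℕ.≤-trans (s≤s z≤n) 2≤a)

2≤a⇒aⁿ≢0 : ∀ {a} n → 2 ℕ.≤ a → ℕ.NonZero (a ^ n)
2≤a⇒aⁿ≢0 {a} n 2≤a = ℕ.m^n≢0 a n {{2≤a⇒a≢0 2≤a}}

^-mono-≤ : ∀ {a b k n} .{{_ : ℕ.NonZero a}} → b ℕ.≤ a → k ℕ.≤ n → b ^ k ℕ.≤ a ^ n
^-mono-≤ {a} {k = k} b≤a k≤n = ℕ.≤-trans (ℕ.^-monoˡ-≤ k b≤a) (ℕ.^-monoʳ-≤ a k≤n)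

dominance : ∀ n a p → 2 ℕ.≤ n → 2 ℕ.≤ a → 2 ℕ.≤ p →
  (n ≡ 2 × a ≡ 2 × p ≡ 2) ⊎ 3 ℕ.* p ℕ.* a ^ n ℕ.< (a ^ n) ^ p
dominance n a (suc (suc (suc q))) 2≤n 2≤a _ = inj₂ (3pN<Nᵖ {{2≤a⇒aⁿ≢0 n 2≤a}} (begin-strict
  3 ℕ.* (3 ℕ.+ q)      <⟨ 3*[3+q]<4^[2+q] q ⟩
  4 ^ (2 ℕ.+ q)        ≤⟨ ℕ.^-monoˡ-≤ (2 ℕ.+ q) (^-mono-≤ {{2≤a⇒a≢0 2≤a}} 2≤a 2≤n) ⟩
  (a ^ n) ^ (2 ℕ.+ q)  ∎))
  where open ℕ.≤-Reasoning
dominance 2 2 2 _ _ _ = inj₁ (refl , refl , refl)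
dominance n@(suc (suc (suc _))) a 2 _ 2≤a _ = inj₂ (3pN<Nᵖ {q = 1} {{2≤a⇒aⁿ≢0 n 2≤a}} (begin-strict
  6                    <⟨ ℕ.+-monoʳ-≤ 7 (z≤n {1}) ⟩
  2 ^ 3                ≤⟨ ^-mono-≤ {b = 2} {k = 3} {n = n} {{2≤a⇒a≢0 2≤a}} 2≤a (s≤s (s≤s (s≤s z≤n))) ⟩
  a ^ n                ≡⟨ ℕ.^-identityʳ (a ^ n) ⟨
  (a ^ n) ^ 1          ∎))
  where open ℕ.≤-Reasoning
dominance 2 a@(suc (suc (suc _))) 2 _ 2≤a _ = inj₂ (3pN<Nᵖ {q = 1} {{2≤a⇒aⁿ≢0 2 2≤a}} (begin-strict
  6                    <⟨ ℕ.+-monoʳ-≤ 7 (z≤n {2}) ⟩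
  3 ^ 2                ≤⟨ ℕ.^-monoˡ-≤ 2 {3} {a} (s≤s (s≤s (s≤s z≤n))) ⟩
  a ^ 2                ≡⟨ ℕ.^-identityʳ (a ^ 2) ⟨
  (a ^ 2) ^ 1          ∎))
  where open ℕ.≤-Reasoning
dominance 1 _ _ (s≤s ()) _ _
dominance _ 1 _ _ (s≤s ()) _
dominance _ _ 1 _ _ (s≤s ())

mainTheorem13 : (n a p : ℕ) → 2 ≤ n → 2 ≤ a → 2 ≤ p →
    (+ p) * sumDivisors n (λ k n/k → μ n/k * (+ (a ^ k)))
      < sumDivisors n (λ k n/k → μ n/k * (+ (a ^ (p Data.Nat.* k))))
mainTheorem13 n@(suc m) a p 2≤n 2≤a 2≤p with dominance n a p 2≤n 2≤a 2≤p
... | inj₁ (refl , refl , refl) = ℤ.+<+ (from-yes (4 ℕ.<? 12))   -- 2 · (2² − 2) < 4² − 4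
... | inj₂ 3paⁿ<aⁿᵖ = subst (+ p * primitiveWordCount n a <_) (primitiveWordCount-^ n a p)
                             (primitiveWordCount-gap m 2≤a (ℕ.≤-trans (s≤s z≤n) 2≤p) 3paⁿ<aⁿᵖ)
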